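{- Let $w=\mu^{\omega}(a)$ where $\mu$ is an injective $r$-uniform morphism ($r\ge2$) on a finite alphabet, prolongable on the letter $a$, and suppose $w$ is periodic. Then the minimal repeating unit of $w$ has no letter appearing twice.
   Context: A morphism $\mu$ satisfies $\mu(uv)=\mu(u)\mu(v)$ for finite $u$; it is $r$-uniform if $|\mu(b)|=r$ for all letters $b$, prolongable on $a$ if $\mu(a)$ begins with $a$, and $\mu^{\omega}(a)$ is the infinite word having each $\mu^n(a)$ as a prefix. An infinite word is periodic if $w=t^{\omega}=ttt\cdots$ for some finite nonempty word $t$; the minimal repeating unit is the shortest such $t$. -}

module Defs where

open import Data.Nat using (ℕ; suc; NonZero)
open import Data.Nat.DivMod using (_%_; m%n<n)
open import Data.Fin using (Fin; toℕ; fromℕ<)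
open import Data.List using (List; []; _∷_; length; lookup; concatMap)
open import Data.Product using (Σ; ∃)
open import Relation.Binary.PropositionalEquality using (_≡_)
open import Function.Definitions using (Injective)

ext : ∀ {k} → (Fin k → List (Fin k)) → List (Fin k) → List (Fin k)
ext μ = concatMap μ

iter : ∀ {k} → (Fin k → List (Fin k)) → ℕ → List (Fin k) → List (Fin k)
iter μ ℕ.zero u = u
iter μ (suc n) u = ext μ (iter μ n u)

Uniform : ∀ {k} → (Fin k → List (Fin k)) → ℕ → Set
Uniform μ r = ∀ b → length (μ b) ≡ r

Prolongable : ∀ {k} → (Fin k → List (Fin k)) → Fin k → Set
Prolongable μ a = ∃ λ u → μ a ≡ a ∷ u

InjectiveMorphism : ∀ {k} → (Fin k → List (Fin k)) → Set
InjectiveMorphism μ = Injective _≡_ _≡_ (ext μ)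

IsPrefixOf : ∀ {k} → List (Fin k) → (ℕ → Fin k) → Set
IsPrefixOf u w = ∀ (j : Fin (length u)) → lookup u j ≡ w (toℕ j)

_^ω : ∀ {k} (t : List (Fin k)) → .{{NonZero (length t)}} → ℕ → Fin k
(t ^ω) i = lookup t (fromℕ< (m%n<n i (length t)))

IsRepeatingUnit : ∀ {k} → (ℕ → Fin k) → List (Fin k) → Set
IsRepeatingUnit w t = Σ (NonZero (length t)) λ nz → ∀ i → w i ≡ (_^ω t {{nz}}) i

Periodic : ∀ {k} → (ℕ → Fin k) → Set
Periodic w = ∃ λ t → IsRepeatingUnit w t

IsMinimalRepeatingUnit : ∀ {k} → (ℕ → Fin k) → List (Fin k) → Set
IsMinimalRepeatingUnit w t =
  Σ (IsRepeatingUnit w t) λ _ → ∀ t' → IsRepeatingUnit w t' → Data.Nat._≤_ (length t) (length t')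

module Submission where

open import Defs
open import Data.Nat using (ℕ; _≥_)
open import Data.Fin using (Fin)
open import Data.List using (List; []; _∷_)
open import Data.List.Relation.Unary.Unique.Propositional using (Unique)

open import Data.Nat using (zero; suc; _+_; _*_; _∸_; _^_; _≤_; _<_; s≤s; z<s; NonZero)
open import Data.Nat.Properties
open import Data.Nat.DivMod using (_%_; _/_; m%n<n; m%n%n≡m%n; [m+n]%n≡m%n; [m+kn]%n≡m%n; m<n⇒m%n≡m; m≡m%n+[m/n]*n; %-distribˡ-+; %-congʳ)
open import Data.Fin using (toℕ; fromℕ<)
open import Data.Fin.Properties using (toℕ<n; toℕ-fromℕ<; fromℕ<-toℕ; fromℕ<-cong; toℕ-injective)
open import Data.List using (length; lookup; applyUpTo; _++_)
open import Data.List.Properties using (length-++; concatMap-++; ++-cancelˡ; ∷-injectiveˡ; ∷-injectiveʳ; length-applyUpTo; lookup-applyUpTo; tabulate-lookup)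
open import Data.List.Relation.Unary.Unique.Propositional.Properties using (tabulate⁺)
open import Data.Product using (∃; _×_; _,_; proj₁; proj₂)
open import Data.Empty using (⊥-elim)
open import Function.Definitions using (Injective)
open import Relation.Binary using (tri<; tri≈; tri>)
open import Relation.Binary.PropositionalEquality
open ≡-Reasoning

-- Write R = r ^ n.  Because w = μ^ω(a) is a fixed point of the
-- r-uniform morphism μ, μ maps the factor w[X, X+L) onto w[rX, rX+rL), hence
-- μ^n maps the single letter w(x) onto the factor w[Rx, Rx+R).  Now let p be
-- the least period of w and suppose w(x) = w(x+e).  Then the factors of length
-- R at Rx and at Rx+Re coincide; once R ≥ p such a long agreement of a
-- p-periodic word forces Re to be a period of w.  Conversely, a period Re means
-- μ^n(w(z)) = μ^n(w(z+e)) for every z, and injectivity of μ gives w(z) = w(z+e):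
-- equal letters of w are a period apart.  Two equal letters at positions
-- x < y < p would thus yield a period 0 < y - x < p, contradicting minimality.

private
  variable
    A : Set

++-prefixes : (xs xs′ : List A) {ys ys′ : List A} →
  length xs ≡ length xs′ → xs ++ ys ≡ xs′ ++ ys′ → xs ≡ xs′
++-prefixes []       []         _   _  = refl
++-prefixes (x ∷ xs) (x′ ∷ xs′) len eq =
  cong₂ _∷_ (∷-injectiveˡ eq) (++-prefixes xs xs′ (suc-injective len) (∷-injectiveʳ eq))

-- n < r ^ n for r ≥ 2; this lets the powers of μ eventually produce long factors.
n<r^n : ∀ r → 1 < r → ∀ n → n < r ^ n
n<r^n r 1<r zero    = z<s
n<r^n r 1<r (suc n) = ≤-<-trans (n<r^n r 1<r n) (^-monoʳ-< r 1<r (n<1+n n))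

factor : (ℕ → A) → ℕ → ℕ → List A
factor w X zero    = []
factor w X (suc L) = w X ∷ factor w (suc X) L

length-factor : ∀ (w : ℕ → A) X L → length (factor w X L) ≡ L
length-factor w X zero    = refl
length-factor w X (suc L) = cong suc (length-factor w (suc X) L)

factor-++ : ∀ (w : ℕ → A) X m n → factor w X (m + n) ≡ factor w X m ++ factor w (X + m) n
factor-++ w X zero    n = cong (λ Y → factor w Y n) (sym (+-identityʳ X))
factor-++ w X (suc m) n = cong (w X ∷_) (begin
  factor w (suc X) (m + n)                  ≡⟨ factor-++ w (suc X) m n ⟩
  factor w (suc X) m ++ factor w (suc X + m) n ≡⟨ cong (λ Y → factor w (suc X) m ++ factor w Y n) (sym (+-suc X m)) ⟩
  factor w (suc X) m ++ factor w (X + suc m) n ∎)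

factor-split : ∀ (w : ℕ → A) X {M N} → M ≤ N →
  factor w X N ≡ factor w X M ++ factor w (X + M) (N ∸ M)
factor-split w X {M} {N} M≤N =
  trans (cong (factor w X) (sym (m+[n∸m]≡n M≤N))) (factor-++ w X M (N ∸ M))

factor-shift : ∀ (w : ℕ → A) X L → factor w (suc X) L ≡ factor (λ i → w (suc i)) X L
factor-shift w X zero    = refl
factor-shift w X (suc L) = cong (w (suc X) ∷_) (factor-shift w (suc X) L)

prefix⇒factor : ∀ {k} (u : List (Fin k)) (w : ℕ → Fin k) →
  IsPrefixOf u w → factor w 0 (length u) ≡ u
prefix⇒factor []      w pre = refl
prefix⇒factor (b ∷ u) w pre = cong₂ _∷_ (sym (pre Fin.zero))
  (trans (factor-shift w 0 (length u)) (prefix⇒factor u _ (λ j → pre (Fin.suc j))))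

factor-pointwise : ∀ (w : ℕ → A) X Y L → factor w X L ≡ factor w Y L →
  ∀ s → s < L → w (X + s) ≡ w (Y + s)
factor-pointwise w X Y (suc L) eq zero    _         = begin
  w (X + 0) ≡⟨ cong w (+-identityʳ X) ⟩
  w X       ≡⟨ ∷-injectiveˡ eq ⟩
  w Y       ≡⟨ cong w (+-identityʳ Y) ⟨
  w (Y + 0) ∎
factor-pointwise w X Y (suc L) eq (suc s) (s≤s s<L) = begin
  w (X + suc s) ≡⟨ cong w (+-suc X s) ⟩
  w (suc X + s) ≡⟨ factor-pointwise w (suc X) (suc Y) L (∷-injectiveʳ eq) s s<L ⟩
  w (suc Y + s) ≡⟨ cong w (+-suc Y s) ⟨
  w (Y + suc s) ∎

-- d is a period of w (d = 0 is allowed and trivial).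
Period : (ℕ → A) → ℕ → Set
Period w d = ∀ z → w z ≡ w (z + d)

period-factor : ∀ {w : ℕ → A} {d} → Period w d → ∀ X L → factor w X L ≡ factor w (X + d) L
period-factor per X zero    = refl
period-factor per X (suc L) = cong₂ _∷_ (per X) (period-factor per (suc X) L)

period-multiple : ∀ {w : ℕ → A} {d} → Period w d → ∀ m z → w z ≡ w (z + m * d)
period-multiple {w = w} per zero    z = cong w (sym (+-identityʳ z))
period-multiple {w = w} {d} per (suc m) z = begin
  w z               ≡⟨ per z ⟩
  w (z + d)         ≡⟨ period-multiple per m (z + d) ⟩
  w (z + d + m * d) ≡⟨ cong w (+-assoc z d (m * d)) ⟩
  w (z + (d + m * d)) ∎

period-residue : ∀ {w : ℕ → A} {p} .{{_ : NonZero p}} → Period w p →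
  ∀ i j → i % p ≡ j % p → w i ≡ w j
period-residue {w = w} {p} per i j eq = begin
  w i                       ≡⟨ cong w (m≡m%n+[m/n]*n i p) ⟩
  w (i % p + i / p * p)     ≡⟨ period-multiple per (i / p) (i % p) ⟨
  w (i % p)                 ≡⟨ cong w eq ⟩
  w (j % p)                 ≡⟨ period-multiple per (j / p) (j % p) ⟩
  w (j % p + j / p * p)     ≡⟨ cong w (m≡m%n+[m/n]*n j p) ⟨
  w j                       ∎

%-cong-+ : ∀ {a b c d p} .{{_ : NonZero p}} → a % p ≡ b % p → c % p ≡ d % p →
  (a + c) % p ≡ (b + d) % p
%-cong-+ {a} {b} {c} {d} {p} ab cd = begin
  (a + c) % p           ≡⟨ %-distribˡ-+ a c p ⟩
  (a % p + c % p) % p   ≡⟨ cong₂ (λ u v → (u + v) % p) ab cd ⟩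
  (b % p + d % p) % p   ≡⟨ %-distribˡ-+ b d p ⟨
  (b + d) % p           ∎

window-residue : ∀ p .{{_ : NonZero p}} X z → ∃ λ s → s < p × (X + s) % p ≡ z % p
window-residue p X z = u % p , m%n<n u p , (begin
  (X + u % p) % p ≡⟨ %-cong-+ refl (m%n%n≡m%n u p) ⟩
  (X + u) % p     ≡⟨ cong (_% p) (m+[n∸m]≡n X≤zXp) ⟩
  (z + X * p) % p ≡⟨ [m+kn]%n≡m%n z X p ⟩
  z % p           ∎)
  where
    u = z + X * p ∸ X
    X≤zXp : X ≤ z + X * p
    X≤zXp = ≤-trans (m≤m*n X p) (m≤n+m (X * p) z)

window-period : ∀ {w : ℕ → A} {p} .{{_ : NonZero p}} → Period w p →
  ∀ X d → (∀ s → s < p → w (X + s) ≡ w (X + d + s)) → Period w d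
window-period {w = w} {p} per X d agree z with window-residue p X z
... | s , s<p , Xs≡z = begin
  w z           ≡⟨ period-residue per z (X + s) (sym Xs≡z) ⟩
  w (X + s)     ≡⟨ agree s s<p ⟩
  w (X + d + s) ≡⟨ period-residue per _ _ (trans (cong (_% p) rearrange) (%-cong-+ Xs≡z refl)) ⟩
  w (z + d)     ∎
  where
    rearrange : X + d + s ≡ X + s + d
    rearrange = begin
      X + d + s   ≡⟨ +-assoc X d s ⟩
      X + (d + s) ≡⟨ cong (X +_) (+-comm d s) ⟩
      X + (s + d) ≡⟨ +-assoc X s d ⟨
      X + s + d   ∎

period⇒unit : ∀ {k} {w : ℕ → Fin k} e → Period w (suc e) → IsRepeatingUnit w (applyUpTo w (suc e))
period⇒unit {w = w} e per = _ , λ i → begin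
  w i                  ≡⟨ period-residue per i (i % n) (sym (m%n%n≡m%n i n)) ⟩
  w (i % n)            ≡⟨ cong w (%-congʳ {o = i} (sym (length-applyUpTo w n))) ⟩
  w (i % length unit)  ≡⟨ cong w (toℕ-fromℕ< (m%n<n i (length unit))) ⟨
  w (toℕ (fromℕ< (m%n<n i (length unit)))) ≡⟨ lookup-applyUpTo w n _ ⟨
  lookup unit (fromℕ< (m%n<n i (length unit))) ∎
  where
    n = suc e
    unit = applyUpTo w n

module _ {k} (μ : Fin k → List (Fin k)) where

  length-ext : ∀ {r} → Uniform μ r → ∀ u → length (ext μ u) ≡ r * length u
  length-ext {r} U []      = sym (*-zeroʳ r)
  length-ext {r} U (b ∷ u) = begin
    length (μ b ++ ext μ u)         ≡⟨ length-++ (μ b) ⟩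
    length (μ b) + length (ext μ u) ≡⟨ cong₂ _+_ (U b) (length-ext U u) ⟩
    r + r * length u                ≡⟨ *-suc r (length u) ⟨
    r * suc (length u)              ∎

  iter-injective : InjectiveMorphism μ → ∀ n → Injective _≡_ _≡_ (iter μ n)
  iter-injective inj zero    eq = eq
  iter-injective inj (suc n) eq = iter-injective inj n (inj eq)

module FixedPoint {k} (μ : Fin k → List (Fin k)) (r : ℕ) (1<r : 1 < r) (U : Uniform μ r)
  (a : Fin k) (w : ℕ → Fin k) (prefixes : ∀ n → IsPrefixOf (iter μ n (a ∷ [])) w) where

  length-iter : ∀ n → length (iter μ n (a ∷ [])) ≡ r ^ n
  length-iter zero    = refl
  length-iter (suc n) = trans (length-ext μ U (iter μ n (a ∷ []))) (cong (r *_) (length-iter n))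

  iter-factor : ∀ n → factor w 0 (r ^ n) ≡ iter μ n (a ∷ [])
  iter-factor n = subst (λ L → factor w 0 L ≡ iter μ n (a ∷ [])) (length-iter n)
    (prefix⇒factor _ w (prefixes n))

  fixed-point : ∀ M → factor w 0 (r * M) ≡ ext μ (factor w 0 M)
  fixed-point M = ++-prefixes (factor w 0 (r * M)) (ext μ (factor w 0 M)) same-length (begin
    factor w 0 (r * M) ++ factor w (r * M) (r * N ∸ r * M) ≡⟨ factor-split w 0 (*-monoʳ-≤ r M≤N) ⟨
    factor w 0 (r * N)                                   ≡⟨ iter-factor (suc M) ⟩
    ext μ (iter μ M (a ∷ []))                             ≡⟨ cong (ext μ) (iter-factor M) ⟨
    ext μ (factor w 0 N)                                 ≡⟨ cong (ext μ) (factor-split w 0 M≤N) ⟩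
    ext μ (factor w 0 M ++ factor w M (N ∸ M))            ≡⟨ concatMap-++ μ (factor w 0 M) (factor w M (N ∸ M)) ⟩
    ext μ (factor w 0 M) ++ ext μ (factor w M (N ∸ M))    ∎)
    where
      N = r ^ M
      M≤N : M ≤ N
      M≤N = <⇒≤ (n<r^n r 1<r M)
      same-length : length (factor w 0 (r * M)) ≡ length (ext μ (factor w 0 M))
      same-length = begin
        length (factor w 0 (r * M))    ≡⟨ length-factor w 0 (r * M) ⟩
        r * M                          ≡⟨ cong (r *_) (length-factor w 0 M) ⟨
        r * length (factor w 0 M)      ≡⟨ length-ext μ U (factor w 0 M) ⟨
        length (ext μ (factor w 0 M))  ∎

  desubstitution : ∀ X L → factor w (r * X) (r * L) ≡ ext μ (factor w X L)
  desubstitution X L = ++-cancelˡ (factor w 0 (r * X)) _ _ (begin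
    factor w 0 (r * X) ++ factor w (r * X) (r * L)  ≡⟨ factor-++ w 0 (r * X) (r * L) ⟨
    factor w 0 (r * X + r * L)                     ≡⟨ cong (factor w 0) (*-distribˡ-+ r X L) ⟨
    factor w 0 (r * (X + L))                       ≡⟨ fixed-point (X + L) ⟩
    ext μ (factor w 0 (X + L))                     ≡⟨ cong (ext μ) (factor-++ w 0 X L) ⟩
    ext μ (factor w 0 X ++ factor w X L)           ≡⟨ concatMap-++ μ (factor w 0 X) (factor w X L) ⟩
    ext μ (factor w 0 X) ++ ext μ (factor w X L)   ≡⟨ cong (_++ ext μ (factor w X L)) (fixed-point X) ⟨
    factor w 0 (r * X) ++ ext μ (factor w X L)     ∎)

  desubstitution-iter : ∀ n X L → factor w (r ^ n * X) (r ^ n * L) ≡ iter μ n (factor w X L)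
  desubstitution-iter zero    X L = cong₂ (factor w) (*-identityˡ X) (*-identityˡ L)
  desubstitution-iter (suc n) X L = begin
    factor w (r * r ^ n * X) (r * r ^ n * L)       ≡⟨ cong₂ (factor w) (*-assoc r (r ^ n) X) (*-assoc r (r ^ n) L) ⟩
    factor w (r * (r ^ n * X)) (r * (r ^ n * L))   ≡⟨ desubstitution (r ^ n * X) (r ^ n * L) ⟩
    ext μ (factor w (r ^ n * X) (r ^ n * L))       ≡⟨ cong (ext μ) (desubstitution-iter n X L) ⟩
    ext μ (iter μ n (factor w X L))                ∎

  letter-image : ∀ n x → factor w (r ^ n * x) (r ^ n) ≡ iter μ n (w x ∷ [])
  letter-image n x = trans (cong (factor w (r ^ n * x)) (sym (*-identityʳ (r ^ n))))
    (desubstitution-iter n x 1)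

  repeat⇒period : InjectiveMorphism μ → ∀ {p} .{{_ : NonZero p}} → Period w p →
    ∀ x e → w x ≡ w (x + e) → Period w e
  repeat⇒period inj {p} per x e repeat z = ∷-injectiveˡ (iter-injective μ inj p (begin
    iter μ p (w z ∷ [])          ≡⟨ letter-image p z ⟨
    factor w (R * z) R           ≡⟨ period-factor period-Re (R * z) R ⟩
    factor w (R * z + R * e) R   ≡⟨ shift-image z ⟩
    iter μ p (w (z + e) ∷ [])    ∎))
    where
      R = r ^ p
      shift-image : ∀ y → factor w (R * y + R * e) R ≡ iter μ p (w (y + e) ∷ [])
      shift-image y = trans (cong (λ Y → factor w Y R) (sym (*-distribˡ-+ R y e))) (letter-image p (y + e))
      agree : factor w (R * x) R ≡ factor w (R * x + R * e) R
      agree = begin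
        factor w (R * x) R           ≡⟨ letter-image p x ⟩
        iter μ p (w x ∷ [])          ≡⟨ cong (λ c → iter μ p (c ∷ [])) repeat ⟩
        iter μ p (w (x + e) ∷ [])    ≡⟨ shift-image x ⟨
        factor w (R * x + R * e) R   ∎
      period-Re : Period w (R * e)
      period-Re = window-period per (R * x) (R * e) λ s s<p →
        factor-pointwise w _ _ R agree s (≤-trans s<p (<⇒≤ (n<r^n r 1<r p)))

module MinimalUnit {k} (w : ℕ → Fin k) (t : List (Fin k)) (min : IsMinimalRepeatingUnit w t) where

  p = length t

  instance
    p-nonZero : NonZero p
    p-nonZero = proj₁ (proj₁ min)

  lookup-unit : ∀ i → lookup t i ≡ w (toℕ i)
  lookup-unit i = sym (begin
    w (toℕ i)                          ≡⟨ proj₂ (proj₁ min) (toℕ i) ⟩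
    lookup t (fromℕ< (m%n<n (toℕ i) p)) ≡⟨ cong (lookup t) (fromℕ<-cong _ _ (m<n⇒m%n≡m (toℕ<n i)) _ (toℕ<n i)) ⟩
    lookup t (fromℕ< (toℕ<n i))        ≡⟨ cong (lookup t) (fromℕ<-toℕ i (toℕ<n i)) ⟩
    lookup t i                         ∎)

  unit-period : Period w p
  unit-period z = begin
    w z                                    ≡⟨ proj₂ (proj₁ min) z ⟩
    lookup t (fromℕ< (m%n<n z p))          ≡⟨ cong (lookup t) (fromℕ<-cong _ _ (sym ([m+n]%n≡m%n z p)) _ _) ⟩
    lookup t (fromℕ< (m%n<n (z + p) p))    ≡⟨ proj₂ (proj₁ min) (z + p) ⟨
    w (z + p)                              ∎

  least-period : ∀ e → 0 < e → Period w e → p ≤ e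
  least-period (suc e) _ per =
    subst (p ≤_) (length-applyUpTo w (suc e)) (proj₂ min _ (period⇒unit e per))

-- The theorem.

theorem13 : (k : ℕ) (μ : Fin k → List (Fin k)) (r : ℕ) (a : Fin k) (w : ℕ → Fin k) →
    r ≥ 2 → InjectiveMorphism μ → Uniform μ r → Prolongable μ a →
    (∀ n → IsPrefixOf (iter μ n (a ∷ [])) w) →
    Periodic w →
    (t : List (Fin k)) → IsMinimalRepeatingUnit w t → Unique t
theorem13 k μ r a w 1<r inj U _ prefixes _ t min =
  subst Unique (tabulate-lookup t) (tabulate⁺ lookup-injective)
  where
    open FixedPoint μ r 1<r U a w prefixes
    open MinimalUnit w t min

    -- no letter repeats at positions x < y < p: their distance would be a shorter period
    no-early-repeat : ∀ {x y} → x < y → y < p → w x ≡ w y → x ≡ y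
    no-early-repeat {x} {y} x<y y<p eq = ⊥-elim (<⇒≱ y<p (≤-trans p≤e (m∸n≤m y x)))
      where
        p≤e : p ≤ y ∸ x
        p≤e = least-period (y ∸ x) (m<n⇒0<n∸m x<y) (repeat⇒period inj unit-period x (y ∸ x)
          (trans eq (cong w (sym (m+[n∸m]≡n (<⇒≤ x<y))))))

    lookup-injective : ∀ {i j} → lookup t i ≡ lookup t j → i ≡ j
    lookup-injective {i} {j} eq with <-cmp (toℕ i) (toℕ j)
    ... | tri< i<j _ _ = toℕ-injective (no-early-repeat i<j (toℕ<n j) eq′)
      where eq′ = trans (sym (lookup-unit i)) (trans eq (lookup-unit j))
    ... | tri≈ _ i≡j _ = toℕ-injective i≡j
    ... | tri> _ _ j<i = toℕ-injective (sym (no-early-repeat j<i (toℕ<n i) eq′))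
      where eq′ = trans (sym (lookup-unit j)) (trans (sym eq) (lookup-unit i))
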